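{- Let $G$ be a graph on $[n]$ and $1\le i<j\le n$ such that there is no path from $i$ to $j$ in $G$ (so $\mathrm{Shift}_{ij}$ is a disjoint shift of $G$). Then (i) if $G$ is chordal, then $\mathrm{Shift}_{ij}(G)$ is chordal; (ii) $|T_k(G)|=|T_k(\mathrm{Shift}_{ij}(G))|$ for all $k$.
   Context: Graphs have no loops or multiple edges; $G$ is chordal if every cycle of length $>3$ has a chord. For $1\le i<j\le n$, $\mathrm{Shift}_{ij}(G)$ is the graph on $[n]$ whose edges are $C_{ij}(S)$ for $S\in E(G)$, where $C_{ij}(S)=(S\setminus\{j\})\cup\{i\}$ if $j\in S$, $i\notin S$ and $(S\setminus\{j\})\cup\{i\}\notin E(G)$, and $C_{ij}(S)=S$ otherwise. For a graph $H$ on $[n]$, $T_k(H)=\{A\subset[n]:|A|=k,\ E(K_A)\subset E(H)\}$, where $K_A$ is the complete graph on $A$. -}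

module Defs where

open import Data.Bool using (Bool; true; false; _∧_; _∨_; if_then_else_; not)
open import Data.Nat using (ℕ; zero; suc; _+_; _≤_; _<_; _≡ᵇ_)
open import Data.Fin using (Fin; toℕ; _≟_) renaming (zero to fzero; suc to fsuc)
open import Data.Fin.Subset using (Subset; _∈_; ∣_∣)
open import Data.Vec using (Vec; []; _∷_; lookup)
open import Data.List using (List; []; _∷_; map; _++_; filterᵇ; length; allFin)
open import Data.Bool.ListAction using (any; all)
open import Data.Product using (Σ; _×_; _,_; proj₁; proj₂; ∃-syntax)
open import Relation.Nullary using (¬_; does)
open import Relation.Binary.PropositionalEquality using (_≡_; _≢_)
open import Function.Definitions using (Injective)

Graph : ℕ → Set
Graph n = Fin n → Fin n → Bool

record IsSimple {n : ℕ} (G : Graph n) : Set where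
  field
    sym    : ∀ x y → G x y ≡ G y x
    irrefl : ∀ x → G x x ≡ false

_==_ : ∀ {n} → Fin n → Fin n → Bool
x == y = does (x ≟ y)

data Path {n : ℕ} (G : Graph n) : Fin n → Fin n → Set where
  here : ∀ {u} → Path G u u
  step : ∀ {u w v} → G u w ≡ true → Path G w v → Path G u v

-- The compression C_ij applied to the edge S = {x , y} of G, returned as an
-- ordered pair representing the unordered edge C_ij(S).
C : ∀ {n} → Fin n → Fin n → Graph n → Fin n → Fin n → Fin n × Fin n
C i j G x y =
  if (y == j) ∧ not (x == i) ∧ not (G x i)
  then (x , i)
  else (if (x == j) ∧ not (y == i) ∧ not (G i y)
        then (i , y)
        else (x , y))

Shift : ∀ {n} → Fin n → Fin n → Graph n → Graph n
Shift {n} i j G a b =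
  any (λ x → any (λ y →
        G x y ∧ (proj₁ (C i j G x y) == a) ∧ (proj₂ (C i j G x y) == b))
      (allFin n)) (allFin n)

record IsCycle {n m : ℕ} (G : Graph n) (c : Fin m → Fin n) : Set where
  field
    distinct : Injective _≡_ _≡_ c
    consec   : ∀ p q → suc (toℕ p) ≡ toℕ q → G (c p) (c q) ≡ true
    closing  : ∀ p q → toℕ p ≡ 0 → suc (toℕ q) ≡ m → G (c q) (c p) ≡ true

HasChord : ∀ {n m : ℕ} → Graph n → (Fin m → Fin n) → Set
HasChord {n} {m} G c =
  ∃[ p ] ∃[ q ] (suc (toℕ p) < toℕ q × ¬ (toℕ p ≡ 0 × suc (toℕ q) ≡ m)
                 × G (c p) (c q) ≡ true)

Chordal : ∀ {n} → Graph n → Set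
Chordal {n} G = ∀ (m : ℕ) (c : Fin m → Fin n) → 4 ≤ m → IsCycle G c → HasChord G c

allSubsets : (n : ℕ) → List (Subset n)
allSubsets zero    = [] ∷ []
allSubsets (suc n) = map (false ∷_) (allSubsets n) ++ map (true ∷_) (allSubsets n)

isCliqueᵇ : ∀ {n} → Graph n → Subset n → Bool
isCliqueᵇ {n} H A =
  all (λ x → all (λ y →
        not (lookup A x) ∨ not (lookup A y) ∨ (x == y) ∨ H x y)
      (allFin n)) (allFin n)

Tcount : ∀ {n} → ℕ → Graph n → ℕ
Tcount {n} k H =
  length (filterᵇ (λ A → (∣ A ∣ ≡ᵇ k) ∧ isCliqueᵇ H A) (allSubsets n))

-- Since no path joins i and j, C_ij sends every edge {x, y} of G to {μ x, μ y}, where μ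
-- merges j into i: Shift_ij(G) is G with the component of j glued onto i. So Shift_ij(G)
-- agrees with G away from the neighbours of j, and on i together with the component of j
-- it agrees with G pulled back along the transposition τ = (i j). A cycle or clique of
-- Shift_ij(G) containing a neighbour of j lies in the second region (for a cycle because
-- deleting i leaves the rest of it connected in G), so τ carries it to a cycle or clique
-- of G; any other one already is a cycle or clique of G. Chords transfer the same way,
-- and relabelling by τ exactly the vertex sets that contain a neighbour of j is a
-- size-preserving involution matching the cliques of G with those of Shift_ij(G).

module Submission where

open import Defs
open import Algebra.Definitions using (Involutive)
open import Data.Bool using (Bool; true; false; if_then_else_; not; _∧_; _∨_)
import Data.Bool.Properties as Bool
open import Data.Bool.Properties using (⇔→≡; ¬-not; T-≡)
open import Data.Bool.ListAction using (all; any)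
open import Data.Nat as ℕ using (ℕ; zero; suc; z≤n; _≡ᵇ_)
import Data.Nat.Properties as ℕ
open import Data.Fin using (Fin; toℕ; fromℕ; inject₁; _≤_; _≤?_; _<_; _≟_) renaming (zero to fzero; suc to fsuc)
open import Data.Fin.Properties using (toℕ-inject₁; toℕ-fromℕ; toℕ≤pred[n]; ≤̄⇒inject₁<; ≤-refl; ≤-trans; ≤-antisym; any?)
open import Data.Fin.Induction using (<-weakInduction; >-weakInduction)
open import Data.Fin.Permutation.Components using (transpose)
open import Data.Fin.Subset using (Subset; ∣_∣)
open import Data.List using ([]; _∷_; map; filterᵇ; length; tabulate; allFin)
open import Data.List.Membership.Propositional using (_∈_; lose)
open import Data.List.Membership.Propositional.Properties using (∈-map⁺; ∈-map⁻; ∈-++⁺ˡ; ∈-++⁺ʳ; ∈-allFin)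
open import Data.List.Membership.Propositional.Properties.WithK using (unique∧set⇒bag)
open import Data.List.Relation.Binary.BagAndSetEquality using (∼bag⇒↭)
open import Data.List.Relation.Binary.Permutation.Propositional using (_↭_)
open import Data.List.Relation.Binary.Permutation.Propositional.Properties using (↭-length; filter-↭)
import Data.List.Relation.Unary.All as All
open import Data.List.Relation.Unary.All.Properties using (all⁺; all⁻; tabulate⁺)
open import Data.List.Relation.Unary.AllPairs.Core using ([]; _∷_)
open import Data.List.Relation.Unary.Any as Any using (here)
open import Data.List.Relation.Unary.Any.Properties using (any⁺; any⁻)
open import Data.List.Relation.Unary.Unique.Propositional using (Unique)
import Data.List.Relation.Unary.Unique.Propositional.Properties as Unique
open import Data.Product using (∃; ∃-syntax; _×_; _,_; proj₁; proj₂)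
open import Data.Sum using (_⊎_; inj₁; inj₂)
import Data.Vec as Vec
open Vec using (lookup)
open import Data.Vec.Properties using (∷-injectiveʳ; lookup∘tabulate; tabulate∘lookup; tabulate-cong)
open import Function using (_∘_; id)
open import Function.Bundles using (_⇔_; mk⇔; Equivalence)
open import Function.Construct.Composition using (_⇔-∘_)
open import Function.Construct.Identity using (⇔-id)
open import Function.Construct.Symmetry using (⇔-sym)
open import Function.Definitions using (Injective)
open import Relation.Nullary using (¬_; Dec; yes; no; does; contradiction)
open import Relation.Nullary.Decidable using (dec-true; dec-false; toSum; _×-dec_)
open import Relation.Binary.PropositionalEquality
  using (_≡_; _≢_; refl; sym; trans; cong; cong₂; subst; subst₂; module ≡-Reasoning)

open ≡-Reasoning

-- Counting through an involution

length-filterᵇ-map : ∀ {A B : Set} (p : B → Bool) (f : A → B) {q : A → Bool} → (∀ x → q x ≡ p (f x)) →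
                     ∀ xs → length (filterᵇ q xs) ≡ length (filterᵇ p (map f xs))
length-filterᵇ-map p f q≗p∘f []       = refl
length-filterᵇ-map p f q≗p∘f (x ∷ xs) rewrite q≗p∘f x with p (f x)
... | true  = cong suc (length-filterᵇ-map p f q≗p∘f xs)
... | false = length-filterᵇ-map p f q≗p∘f xs

module _ {A : Set} {f : A → A} (f-involutive : Involutive _≡_ f) where

  involutive⇒injective : ∀ {x y} → f x ≡ f y → x ≡ y
  involutive⇒injective {x} {y} fx≡fy = trans (sym (f-involutive x)) (trans (cong f fx≡fy) (f-involutive y))

  map-involution-↭ : ∀ {xs} → Unique xs → (∀ x → x ∈ xs) → map f xs ↭ xs
  map-involution-↭ {xs} unique complete =
    ∼bag⇒↭ (unique∧set⇒bag (Unique.map⁺ involutive⇒injective unique) unique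
      (λ {x} → mk⇔ (λ _ → complete x) (λ _ → subst (_∈ map f xs) (f-involutive x) (∈-map⁺ f (complete (f x))))))

  length-filterᵇ-involution : ∀ (p : A → Bool) {q : A → Bool} → (∀ x → q x ≡ p (f x)) →
                              ∀ {xs} → Unique xs → (∀ x → x ∈ xs) →
                              length (filterᵇ q xs) ≡ length (filterᵇ p xs)
  length-filterᵇ-involution p {q} q≗p∘f {xs} unique complete = begin
    length (filterᵇ q xs)          ≡⟨ length-filterᵇ-map p f q≗p∘f xs ⟩
    length (filterᵇ p (map f xs))  ≡⟨ ↭-length (filter-↭ _ (map-involution-↭ unique complete)) ⟩
    length (filterᵇ p xs)          ∎

∣tabulate∣ : ∀ {n} {B : Set} (p : B → Bool) (h : Fin n → B) →
             ∣ Vec.tabulate (p ∘ h) ∣ ≡ length (filterᵇ p (tabulate h))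
∣tabulate∣ {zero}  p h = refl
∣tabulate∣ {suc n} p h with p (h fzero)
... | true  = cong suc (∣tabulate∣ p (h ∘ fsuc))
... | false = ∣tabulate∣ p (h ∘ fsuc)

relabel : ∀ {n} → (Fin n → Fin n) → Subset n → Subset n
relabel f A = Vec.tabulate (lookup A ∘ f)

lookup-relabel : ∀ {n} (f : Fin n → Fin n) A x → lookup (relabel f A) x ≡ lookup A (f x)
lookup-relabel f A = lookup∘tabulate (lookup A ∘ f)

module _ {n} {f : Fin n → Fin n} (f-involutive : Involutive _≡_ f) where

  relabel-involutive : Involutive _≡_ (relabel f)
  relabel-involutive A = begin
    relabel f (relabel f A)  ≡⟨ tabulate-cong lookup-twice ⟩
    Vec.tabulate (lookup A)  ≡⟨ tabulate∘lookup A ⟩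
    A                        ∎
    where
    lookup-twice : ∀ x → lookup (relabel f A) (f x) ≡ lookup A x
    lookup-twice x = trans (lookup-relabel f A (f x)) (cong (lookup A) (f-involutive x))

  ∣relabel∣ : ∀ A → ∣ relabel f A ∣ ≡ ∣ A ∣
  ∣relabel∣ A = begin
    ∣ relabel f A ∣                          ≡⟨ ∣tabulate∣ (lookup A ∘ f) id ⟩
    length (filterᵇ (lookup A ∘ f) (allFin n)) ≡⟨ length-filterᵇ-involution f-involutive (lookup A) (λ _ → refl)
                                                    (Unique.allFin⁺ n) ∈-allFin ⟩
    length (filterᵇ (lookup A) (allFin n))     ≡⟨ sym (∣tabulate∣ (lookup A) id) ⟩
    ∣ Vec.tabulate (lookup A) ∣              ≡⟨ cong ∣_∣ (tabulate∘lookup A) ⟩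
    ∣ A ∣                                    ∎

allSubsets-unique : ∀ n → Unique (allSubsets n)
allSubsets-unique zero    = All.[] ∷ []
allSubsets-unique (suc n) =
  Unique.++⁺ (Unique.map⁺ ∷-injectiveʳ (allSubsets-unique n)) (Unique.map⁺ ∷-injectiveʳ (allSubsets-unique n))
             disjoint
  where
  disjoint : ∀ {A} → ¬ (A ∈ map (false Vec.∷_) (allSubsets n) × A ∈ map (true Vec.∷_) (allSubsets n))
  disjoint (A∈outside , A∈inside) with ∈-map⁻ (false Vec.∷_) A∈outside | ∈-map⁻ (true Vec.∷_) A∈inside
  ... | _ , _ , refl | _ , _ , ()

∈-allSubsets : ∀ {n} (A : Subset n) → A ∈ allSubsets n
∈-allSubsets Vec.[]          = here refl
∈-allSubsets (false Vec.∷ A) = ∈-++⁺ˡ (∈-map⁺ (false Vec.∷_) (∈-allSubsets A))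
∈-allSubsets {suc n} (true Vec.∷ A) =
  ∈-++⁺ʳ (map (false Vec.∷_) (allSubsets n)) (∈-map⁺ (true Vec.∷_) (∈-allSubsets A))

-- Cliques

record IsClique {n} (H : Graph n) (A : Subset n) : Set where
  constructor clique
  field
    adjacent : ∀ {x y} → lookup A x ≡ true → lookup A y ≡ true → x ≢ y → H x y ≡ true

open IsClique public

all-allFin⇔ : ∀ {n} (p : Fin n → Bool) → all p (allFin n) ≡ true ⇔ (∀ x → p x ≡ true)
all-allFin⇔ {n} p = mk⇔
  (λ e x → Equivalence.to T-≡ (All.lookup (all⁺ p (allFin n) (Equivalence.from T-≡ e)) (∈-allFin x)))
  (λ h → Equivalence.to T-≡ (all⁻ p (tabulate⁺ (Equivalence.from T-≡ ∘ h))))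

any-allFin⇔ : ∀ {n} (p : Fin n → Bool) → any p (allFin n) ≡ true ⇔ (∃ λ x → p x ≡ true)
any-allFin⇔ {n} p = mk⇔
  (λ e → let x , px = Any.satisfied (any⁻ p (allFin n) (Equivalence.from T-≡ e)) in x , Equivalence.to T-≡ px)
  (λ (x , px) → Equivalence.to T-≡ (any⁺ p (lose (∈-allFin x) (Equivalence.from T-≡ px))))

isCliqueᵇ⇔IsClique : ∀ {n} (H : Graph n) A → isCliqueᵇ H A ≡ true ⇔ IsClique H A
isCliqueᵇ⇔IsClique {n} H A = mk⇔ to from
  where
  entry : Fin n → Fin n → Bool
  entry x y = not (lookup A x) ∨ not (lookup A y) ∨ (x == y) ∨ H x y
  entry-holds : ∀ x y → entry x y ≡ true → lookup A x ≡ true → lookup A y ≡ true → x ≢ y → H x y ≡ true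
  entry-holds x y e Ax Ay x≢y with x ≟ y
  ... | yes x≡y = contradiction x≡y x≢y
  ... | no _ rewrite Ax | Ay = e
  holds-entry : ∀ x y → (lookup A x ≡ true → lookup A y ≡ true → x ≢ y → H x y ≡ true) → entry x y ≡ true
  holds-entry x y h with lookup A x | lookup A y | x ≟ y
  ... | false | _     | _        = refl
  ... | true  | false | _        = refl
  ... | true  | true  | yes _    = refl
  ... | true  | true  | no x≢y   = h refl refl x≢y
  to : isCliqueᵇ H A ≡ true → IsClique H A
  to e = clique λ {x} {y} →
    entry-holds x y (Equivalence.to (all-allFin⇔ (entry x)) (Equivalence.to (all-allFin⇔ _) e x) y)
  from : IsClique H A → isCliqueᵇ H A ≡ true
  from c = Equivalence.from (all-allFin⇔ _) λ x → Equivalence.from (all-allFin⇔ _) λ y → holds-entry x y (adjacent c)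

module _ {n} {H₁ H₂ : Graph n} {A : Subset n} where

  IsClique-cong : (∀ {x y} → lookup A x ≡ true → lookup A y ≡ true → H₁ x y ≡ H₂ x y) →
                  IsClique H₁ A → IsClique H₂ A
  IsClique-cong agree c = clique λ Ax Ay x≢y → trans (sym (agree Ax Ay)) (adjacent c Ax Ay x≢y)

module _ {n} {f : Fin n → Fin n} (f-involutive : Involutive _≡_ f) (H : Graph n) (A : Subset n) where

  IsClique-relabel : IsClique H (relabel f A) ⇔ IsClique (λ x y → H (f x) (f y)) A
  IsClique-relabel = mk⇔ to from
    where
    f-member : ∀ {x} → lookup A x ≡ true → lookup (relabel f A) (f x) ≡ true
    f-member {x} Ax = trans (lookup-relabel f A (f x)) (trans (cong (lookup A) (f-involutive x)) Ax)
    to : IsClique H (relabel f A) → IsClique (λ x y → H (f x) (f y)) A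
    to c = clique λ Ax Ay x≢y → adjacent c (f-member Ax) (f-member Ay) (x≢y ∘ involutive⇒injective f-involutive)
    from : IsClique (λ x y → H (f x) (f y)) A → IsClique H (relabel f A)
    from c = clique λ {x} {y} Ax Ay x≢y → subst₂ (λ u v → H u v ≡ true) (f-involutive x) (f-involutive y)
      (adjacent c (trans (sym (lookup-relabel f A x)) Ax) (trans (sym (lookup-relabel f A y)) Ay)
                  (x≢y ∘ involutive⇒injective f-involutive))

isCliqueᵇ-cong : ∀ {n} {H₁ H₂ : Graph n} {A B : Subset n} →
                 IsClique H₁ A ⇔ IsClique H₂ B → isCliqueᵇ H₁ A ≡ isCliqueᵇ H₂ B
isCliqueᵇ-cong {H₁ = H₁} {H₂} {A} {B} A⇔B =
  ⇔→≡ (⇔-sym (isCliqueᵇ⇔IsClique H₂ B) ⇔-∘ (A⇔B ⇔-∘ isCliqueᵇ⇔IsClique H₁ A))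

Tcount-invariant : ∀ {n} {H₁ H₂ : Graph n} (h : Subset n → Subset n) → Involutive _≡_ h →
                   (∀ A → ∣ h A ∣ ≡ ∣ A ∣) → (∀ A → isCliqueᵇ H₂ A ≡ isCliqueᵇ H₁ (h A)) →
                   ∀ k → Tcount k H₁ ≡ Tcount k H₂
Tcount-invariant {n} h h-involutive ∣h∣ clique-h k =
  sym (length-filterᵇ-involution {f = h} h-involutive _
         (λ A → cong₂ (λ c b → (c ≡ᵇ k) ∧ b) (sym (∣h∣ A)) (clique-h A)) (allSubsets-unique n) ∈-allSubsets)

-- Cycles

inject₁≤suc : ∀ {m} (p : Fin m) → inject₁ p ≤ fsuc p
inject₁≤suc p = ℕ.<⇒≤ (≤̄⇒inject₁< (≤-refl {x = p}))

module _ {n m} {H : Graph n} {c : Fin (suc m) → Fin n} (cycle : IsCycle H c)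
         (v : Fin n) (Q : Fin n → Set) (Q-edge : ∀ {x y} → H x y ≡ true → x ≢ v → y ≢ v → Q x ⇔ Q y) where

  private
    last : Fin (suc m)
    last = fromℕ m

    step-edge : ∀ p → H (c (inject₁ p)) (c (fsuc p)) ≡ true
    step-edge p = IsCycle.consec cycle (inject₁ p) (fsuc p) (cong suc (toℕ-inject₁ p))

    closing-edge : H (c last) (c fzero) ≡ true
    closing-edge = IsCycle.closing cycle fzero last refl (cong suc (toℕ-fromℕ m))

    prefix-linked : ∀ p → (∀ r → r ≤ p → c r ≢ v) → Q (c fzero) ⇔ Q (c p)
    prefix-linked = <-weakInduction _ (λ _ → ⇔-id _) λ p ih avoid →
      Q-edge (step-edge p) (avoid _ (inject₁≤suc p)) (avoid _ ℕ.≤-refl)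
        ⇔-∘ ih (λ r r≤p → avoid r (≤-trans r≤p (inject₁≤suc p)))

    suffix-linked : ∀ p → (∀ r → p ≤ r → c r ≢ v) → Q (c p) ⇔ Q (c last)
    suffix-linked = >-weakInduction _ (λ _ → ⇔-id _) λ p ih avoid →
      ih (λ r p<r → avoid r (≤-trans (inject₁≤suc p) p<r))
        ⇔-∘ Q-edge (step-edge p) (avoid _ ℕ.≤-refl) (avoid _ (inject₁≤suc p))

    ≤-last : ∀ (p : Fin (suc m)) → p ≤ last
    ≤-last p = subst (toℕ p ℕ.≤_) (sym (toℕ-fromℕ m)) (toℕ≤pred[n] p)

    around : c fzero ≢ v → c last ≢ v → Q (c fzero) ⇔ Q (c last)
    around c0≢v clast≢v = ⇔-sym (Q-edge closing-edge clast≢v c0≢v)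

    prefix-or-suffix : ∀ p → c p ≢ v → (∀ r → r ≤ p → c r ≢ v) ⊎ (∀ r → p ≤ r → c r ≢ v)
    prefix-or-suffix p cp≢v with any? (λ r → (r ≤? p) ×-dec (c r ≟ v))
    ... | no  ∄ = inj₁ λ r r≤p cr≡v → ∄ (r , r≤p , cr≡v)
    ... | yes (t , t≤p , ct≡v) = inj₂ suffix
      where
      suffix : ∀ r → p ≤ r → c r ≢ v
      suffix r p≤r cr≡v = cp≢v (trans (cong c (≤-antisym p≤r r≤p)) cr≡v)
        where
        r≤p : r ≤ p
        r≤p = subst (_≤ p) (IsCycle.distinct cycle (trans ct≡v (sym cr≡v))) t≤p

  -- The cycle visits v at most once; the positions before that visit and those after it
  -- form two paths avoiding v, joined by the closing edge.
  cycle-connected-avoiding : ∀ p q → c p ≢ v → c q ≢ v → Q (c p) ⇔ Q (c q)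
  cycle-connected-avoiding p q cp≢v cq≢v with prefix-or-suffix p cp≢v | prefix-or-suffix q cq≢v
  ... | inj₁ p-pre | inj₁ q-pre = prefix-linked q q-pre ⇔-∘ ⇔-sym (prefix-linked p p-pre)
  ... | inj₂ p-suf | inj₂ q-suf = ⇔-sym (suffix-linked q q-suf) ⇔-∘ suffix-linked p p-suf
  ... | inj₁ p-pre | inj₂ q-suf =
    ⇔-sym (suffix-linked q q-suf)
      ⇔-∘ (around (p-pre fzero z≤n) (q-suf last (≤-last q)) ⇔-∘ ⇔-sym (prefix-linked p p-pre))
  ... | inj₂ p-suf | inj₁ q-pre =
    prefix-linked q q-pre
      ⇔-∘ (⇔-sym (around (q-pre fzero z≤n) (p-suf last (≤-last p))) ⇔-∘ suffix-linked p p-suf)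

HasChord-transfer : ∀ {n m} {H₁ H₂ : Graph n} {c d : Fin m → Fin n} → Chordal H₂ → 4 ℕ.≤ m →
                    Injective _≡_ _≡_ d → (∀ p q → H₁ (c p) (c q) ≡ H₂ (d p) (d q)) →
                    IsCycle H₁ c → HasChord H₁ c
HasChord-transfer {m = m} {d = d} chordal 4≤m d-injective agree cycle
  with chordal m d 4≤m record
    { distinct = d-injective
    ; consec   = λ p q adjacent → trans (sym (agree p q)) (IsCycle.consec cycle p q adjacent)
    ; closing  = λ p q first last → trans (sym (agree q p)) (IsCycle.closing cycle p q first last)
    }
... | p , q , apart , not-closing , chord = p , q , apart , not-closing , trans (agree p q) chord

-- The disjoint shift

module DisjointShift {n} (G : Graph n) (i j : Fin n) (simple : IsSimple G) (i↛j : ¬ Path G i j) where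

  open IsSimple simple renaming (sym to G-sym; irrefl to G-irrefl)

  data Position (x : Fin n) : Set where
    at-i  : x ≡ i → Position x
    at-j  : x ≡ j → Position x
    other : x ≢ i → x ≢ j → Position x

  position : ∀ x → Position x
  position x with x ≟ i | x ≟ j
  ... | yes x≡i | _       = at-i x≡i
  ... | no  _   | yes x≡j = at-j x≡j
  ... | no x≢i  | no x≢j  = other x≢i x≢j

  τ : Fin n → Fin n
  τ = transpose i j

  τ-i : τ i ≡ j
  τ-i with i ≟ i
  ... | yes _   = refl
  ... | no i≢i  = contradiction refl i≢i

  τ-j : τ j ≡ i
  τ-j with j ≟ i
  ... | yes j≡i = j≡i
  ... | no _ rewrite dec-true (j ≟ j) refl = refl

  τ-fix : ∀ {x} → x ≢ i → x ≢ j → τ x ≡ x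
  τ-fix {x} x≢i x≢j with x ≟ i
  ... | yes x≡i = contradiction x≡i x≢i
  ... | no _ rewrite dec-false (x ≟ j) x≢j = refl

  τ-involutive : Involutive _≡_ τ
  τ-involutive x with position x
  ... | at-i refl = trans (cong τ τ-i) τ-j
  ... | at-j refl = trans (cong τ τ-j) τ-i
  ... | other x≢i x≢j = trans (cong τ (τ-fix x≢i x≢j)) (τ-fix x≢i x≢j)

  μ : Fin n → Fin n
  μ x = if does (x ≟ j) then i else x

  μ-j : μ j ≡ i
  μ-j rewrite dec-true (j ≟ j) refl = refl

  μ-fix : ∀ {x} → x ≢ j → μ x ≡ x
  μ-fix {x} x≢j rewrite dec-false (x ≟ j) x≢j = refl

  μ∘τ : ∀ {a} → a ≢ j → μ (τ a) ≡ a
  μ∘τ {a} a≢j with position a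
  ... | at-i refl     = trans (cong μ τ-i) μ-j
  ... | at-j a≡j      = contradiction a≡j a≢j
  ... | other a≢i _   = trans (cong μ (τ-fix a≢i a≢j)) (μ-fix a≢j)

  τ∘μ : ∀ {x} → x ≢ i → τ (μ x) ≡ x
  τ∘μ {x} x≢i with position x
  ... | at-i x≡i      = contradiction x≡i x≢i
  ... | at-j refl     = trans (cong τ μ-j) τ-i
  ... | other _ x≢j   = trans (cong τ (μ-fix x≢j)) (τ-fix x≢i x≢j)

  μ-fibre : ∀ {x a} → μ x ≡ a → a ≢ i → x ≡ a
  μ-fibre {x} μx≡a a≢i with x ≟ j
  ... | yes _ = contradiction (sym μx≡a) a≢i
  ... | no _  = μx≡a

  edge⇒≢ : ∀ {x y} → G x y ≡ true → x ≢ y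
  edge⇒≢ {x} e refl with () ← trans (sym e) (G-irrefl x)

  j-neighbour-≢i : ∀ {x} → G x j ≡ true → x ≢ i
  j-neighbour-≢i e refl = i↛j (step e here)

  j-neighbour-≁i : ∀ {x} → G x j ≡ true → G i x ≡ false
  j-neighbour-≁i e = ¬-not λ e′ → i↛j (step e′ (step e here))

  C-into-j : ∀ {x} → G x j ≡ true → C i j G x j ≡ (x , i)
  C-into-j {x} e
    rewrite dec-true (j ≟ j) refl | dec-false (x ≟ i) (j-neighbour-≢i e) | G-sym x i | j-neighbour-≁i e = refl

  C-out-of-j : ∀ {y} → y ≢ j → G j y ≡ true → C i j G j y ≡ (i , y)
  C-out-of-j {y} y≢j e
    rewrite dec-false (y ≟ j) y≢j | dec-true (j ≟ j) refl
          | dec-false (y ≟ i) (j-neighbour-≢i (trans (G-sym y j) e)) | j-neighbour-≁i (trans (G-sym y j) e) = refl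

  C-away-from-j : ∀ {x y} → x ≢ j → y ≢ j → C i j G x y ≡ (x , y)
  C-away-from-j {x} {y} x≢j y≢j rewrite dec-false (y ≟ j) y≢j | dec-false (x ≟ j) x≢j = refl

  -- Matching on toSum rather than on x ≟ j keeps the tests inside C and μ from being
  -- abstracted, so the three lemmas above still apply.
  C-edge : ∀ {x y} → G x y ≡ true → C i j G x y ≡ (μ x , μ y)
  C-edge {x} {y} e with toSum (x ≟ j) | toSum (y ≟ j)
  C-edge {.j} {.j} e | inj₁ refl | inj₁ refl = contradiction refl (edge⇒≢ e)
  C-edge {.j} {y}  e | inj₁ refl | inj₂ y≢j  = trans (C-out-of-j y≢j e) (cong₂ _,_ (sym μ-j) (sym (μ-fix y≢j)))
  C-edge {x}  {.j} e | inj₂ x≢j  | inj₁ refl = trans (C-into-j e) (cong₂ _,_ (sym (μ-fix x≢j)) (sym μ-j))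
  C-edge {x}  {y}  e | inj₂ x≢j  | inj₂ y≢j  =
    trans (C-away-from-j x≢j y≢j) (cong₂ _,_ (sym (μ-fix x≢j)) (sym (μ-fix y≢j)))

  shift-image : ∀ {a b} → Shift i j G a b ≡ true ⇔ (∃[ x ] ∃[ y ] (G x y ≡ true × μ x ≡ a × μ y ≡ b))
  shift-image {a} {b} = mk⇔ to from
    where
    compresses-to : Fin n → Fin n → Bool
    compresses-to x y = G x y ∧ (proj₁ (C i j G x y) == a) ∧ (proj₂ (C i j G x y) == b)
    compresses-to⇔ : ∀ x y → compresses-to x y ≡ true ⇔ (G x y ≡ true × μ x ≡ a × μ y ≡ b)
    compresses-to⇔ x y with G x y in Gxy
    ... | false = mk⇔ (λ ()) (λ ())
    ... | true rewrite C-edge Gxy with μ x ≟ a | μ y ≟ b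
    ...   | yes μx≡a | yes μy≡b = mk⇔ (λ _ → refl , μx≡a , μy≡b) (λ _ → refl)
    ...   | yes _    | no μy≢b  = mk⇔ (λ ()) (λ (_ , _ , μy≡b) → contradiction μy≡b μy≢b)
    ...   | no μx≢a  | _        = mk⇔ (λ ()) (λ (_ , μx≡a , _) → contradiction μx≡a μx≢a)
    to : Shift i j G a b ≡ true → ∃[ x ] ∃[ y ] (G x y ≡ true × μ x ≡ a × μ y ≡ b)
    to e with Equivalence.to (any-allFin⇔ _) e
    ... | x , e′ with Equivalence.to (any-allFin⇔ _) e′
    ... | y , e″ = x , y , Equivalence.to (compresses-to⇔ x y) e″
    from : ∃[ x ] ∃[ y ] (G x y ≡ true × μ x ≡ a × μ y ≡ b) → Shift i j G a b ≡ true
    from (x , y , spec) = Equivalence.from (any-allFin⇔ _) (x , Equivalence.from (any-allFin⇔ _) (y ,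
      Equivalence.from (compresses-to⇔ x y) spec))

  JSide : Fin n → Set
  JSide a = a ≡ i ⊎ Path G a j

  i≁τ-JSide : ∀ {b} → JSide b → G i (τ b) ≢ true
  i≁τ-JSide {b} side e with position b | side
  ... | at-i b≡i      | _        = i↛j (step (trans (cong (G i) (sym (trans (cong τ b≡i) τ-i))) e) here)
  ... | at-j b≡j      | _        = edge⇒≢ (trans (cong (G i) (sym (trans (cong τ b≡j) τ-j))) e) refl
  ... | other b≢i _   | inj₁ b≡i = contradiction b≡i b≢i
  ... | other b≢i b≢j | inj₂ b⇝j = i↛j (step (trans (cong (G i) (sym (τ-fix b≢i b≢j))) e) b⇝j)

  shift-on-JSide : ∀ {a b} → JSide a → JSide b → Shift i j G a b ≡ G (τ a) (τ b)
  shift-on-JSide {a} {b} a-side b-side = ⇔→≡ (mk⇔ to from)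
    where
    to : Shift i j G a b ≡ true → G (τ a) (τ b) ≡ true
    to shifted with Equivalence.to shift-image shifted
    ... | x , y , e , refl , refl = subst₂ (λ u v → G u v ≡ true) (sym (τ∘μ x≢i)) (sym (τ∘μ y≢i)) e
      where
      x≢i : x ≢ i
      x≢i refl = i≁τ-JSide b-side (trans (cong (G i) (τ∘μ (edge⇒≢ e ∘ sym))) e)
      y≢i : y ≢ i
      y≢i refl = i≁τ-JSide a-side (trans (cong (G i) (τ∘μ (edge⇒≢ e))) (trans (G-sym i x) e))
    from : G (τ a) (τ b) ≡ true → Shift i j G a b ≡ true
    from e = Equivalence.from shift-image (τ a , τ b , e , μ∘τ a≢j , μ∘τ b≢j)
      where
      a≢j : a ≢ j
      a≢j refl = i≁τ-JSide b-side (trans (cong (λ v → G v (τ b)) (sym τ-j)) e)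
      b≢j : b ≢ j
      b≢j refl = i≁τ-JSide a-side (trans (G-sym i (τ a)) (trans (cong (G (τ a)) (sym τ-j)) e))

  shift-off-j-neighbourhood : ∀ {a b} → G j a ≡ false → G j b ≡ false → Shift i j G a b ≡ G a b
  shift-off-j-neighbourhood {a} {b} j≁a j≁b = ⇔→≡ (mk⇔ to from)
    where
    edge-from-j : ∀ {y} → G j y ≡ true → G j (μ y) ≡ true
    edge-from-j e = trans (cong (G j) (μ-fix (edge⇒≢ e ∘ sym))) e
    to : Shift i j G a b ≡ true → G a b ≡ true
    to shifted with Equivalence.to shift-image shifted
    ... | x , y , e , refl , refl = subst₂ (λ u v → G u v ≡ true) (sym (μ-fix x≢j)) (sym (μ-fix y≢j)) e
      where
      x≢j : x ≢ j
      x≢j refl with () ← trans (sym j≁b) (edge-from-j e)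
      y≢j : y ≢ j
      y≢j refl with () ← trans (sym j≁a) (edge-from-j (trans (G-sym j x) e))
    from : G a b ≡ true → Shift i j G a b ≡ true
    from e = Equivalence.from shift-image (a , b , e , μ-fix a≢j , μ-fix b≢j)
      where
      a≢j : a ≢ j
      a≢j refl with () ← trans (sym j≁b) e
      b≢j : b ≢ j
      b≢j refl with () ← trans (sym j≁a) (trans (G-sym j a) e)

  shift-avoiding-i : ∀ {a b} → Shift i j G a b ≡ true → a ≢ i → b ≢ i → G a b ≡ true
  shift-avoiding-i shifted a≢i b≢i with Equivalence.to shift-image shifted
  ... | x , y , e , μx≡a , μy≡b = subst₂ (λ u v → G u v ≡ true) (μ-fibre μx≡a a≢i) (μ-fibre μy≡b b≢i) e

  path-along-shift : ∀ {x y} → Shift i j G x y ≡ true → x ≢ i → y ≢ i → Path G x j ⇔ Path G y j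
  path-along-shift {x} {y} shifted x≢i y≢i = mk⇔ (step (trans (G-sym y x) x∼y)) (step x∼y)
    where
    x∼y : G x y ≡ true
    x∼y = shift-avoiding-i shifted x≢i y≢i

  chordal-shift : Chordal G → Chordal (Shift i j G)
  chordal-shift chordal zero    c ()  cycle
  chordal-shift chordal (suc m) c 4≤m cycle with any? (λ p → G j (c p) Bool.≟ true)
  ... | no ∄ =
    HasChord-transfer chordal 4≤m (IsCycle.distinct cycle)
                      (λ p q → shift-off-j-neighbourhood (¬-not (∄ ∘ (p ,_))) (¬-not (∄ ∘ (q ,_)))) cycle
  ... | yes (p₀ , j∼cp₀) =
    HasChord-transfer chordal 4≤m (IsCycle.distinct cycle ∘ involutive⇒injective {f = τ} τ-involutive)
                      (λ p q → shift-on-JSide (side p) (side q)) cycle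
    where
    cp₀∼j : G (c p₀) j ≡ true
    cp₀∼j = trans (G-sym (c p₀) j) j∼cp₀
    side : ∀ q → JSide (c q)
    side q with c q ≟ i
    ... | yes cq≡i = inj₁ cq≡i
    ... | no  cq≢i = inj₂ (Equivalence.to
      (cycle-connected-avoiding cycle i (λ x → Path G x j) path-along-shift p₀ q (j-neighbour-≢i cp₀∼j) cq≢i)
      (step cp₀∼j here))

  Meets-j-neighbour : Subset n → Set
  Meets-j-neighbour A = ∃[ x ] (lookup A x ≡ true × G j x ≡ true)

  meets-j-neighbour? : ∀ A → Dec (Meets-j-neighbour A)
  meets-j-neighbour? A = any? (λ x → (lookup A x Bool.≟ true) ×-dec (G j x Bool.≟ true))

  swap-if-meets : Subset n → Subset n
  swap-if-meets A = if does (meets-j-neighbour? A) then relabel τ A else A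

  meets-relabel : ∀ {A} → Meets-j-neighbour A → Meets-j-neighbour (relabel τ A)
  meets-relabel {A} (x , Ax , j∼x) = x , trans (lookup-relabel τ A x) (trans (cong (lookup A) τx≡x) Ax) , j∼x
    where
    x∼j : G x j ≡ true
    x∼j = trans (G-sym x j) j∼x
    τx≡x : τ x ≡ x
    τx≡x = τ-fix (j-neighbour-≢i x∼j) (edge⇒≢ x∼j)

  swap-if-meets-involutive : Involutive _≡_ swap-if-meets
  swap-if-meets-involutive A with meets-j-neighbour? A
  ... | yes meets rewrite dec-true (meets-j-neighbour? (relabel τ A)) (meets-relabel {A} meets) =
    relabel-involutive τ-involutive A
  ... | no ¬meets rewrite dec-false (meets-j-neighbour? A) ¬meets = refl

  ∣swap-if-meets∣ : ∀ A → ∣ swap-if-meets A ∣ ≡ ∣ A ∣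
  ∣swap-if-meets∣ A with does (meets-j-neighbour? A)
  ... | true  = ∣relabel∣ τ-involutive A
  ... | false = refl

  JSide-near : ∀ {x₀ a} → G x₀ j ≡ true → (a ≢ i → a ≢ j → a ≢ x₀ → G a x₀ ≡ true) → JSide a
  JSide-near {x₀} {a} x₀∼j adjacent with position a | a ≟ x₀
  ... | at-i a≡i      | _        = inj₁ a≡i
  ... | at-j a≡j      | _        = inj₂ (subst (λ v → Path G v j) (sym a≡j) here)
  ... | other _ _     | yes a≡x₀ = inj₂ (subst (λ v → Path G v j) (sym a≡x₀) (step x₀∼j here))
  ... | other a≢i a≢j | no a≢x₀  = inj₂ (step (adjacent a≢i a≢j a≢x₀) (step x₀∼j here))

  clique-meeting-j-neighbour : ∀ {A x₀} → lookup A x₀ ≡ true → G j x₀ ≡ true →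
                               IsClique (Shift i j G) A ⇔ IsClique G (relabel τ A)
  clique-meeting-j-neighbour {A} {x₀} Ax₀ j∼x₀ = ⇔-sym (IsClique-relabel τ-involutive G A) ⇔-∘ mk⇔ to from
    where
    x₀∼j : G x₀ j ≡ true
    x₀∼j = trans (G-sym x₀ j) j∼x₀
    x₀≢i : x₀ ≢ i
    x₀≢i = j-neighbour-≢i x₀∼j
    x₀≢j : x₀ ≢ j
    x₀≢j = edge⇒≢ x₀∼j
    to : IsClique (Shift i j G) A → IsClique (λ x y → G (τ x) (τ y)) A
    to c = IsClique-cong (λ Ax Ay → shift-on-JSide (side Ax) (side Ay)) c
      where
      side : ∀ {a} → lookup A a ≡ true → JSide a
      side Aa = JSide-near x₀∼j λ a≢i _ a≢x₀ → shift-avoiding-i (adjacent c Aa Ax₀ a≢x₀) a≢i x₀≢i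
    from : IsClique (λ x y → G (τ x) (τ y)) A → IsClique (Shift i j G) A
    from c = IsClique-cong (λ Ax Ay → sym (shift-on-JSide (side Ax) (side Ay))) c
      where
      side : ∀ {a} → lookup A a ≡ true → JSide a
      side Aa = JSide-near x₀∼j λ a≢i a≢j a≢x₀ →
        subst₂ (λ u v → G u v ≡ true) (τ-fix a≢i a≢j) (τ-fix x₀≢i x₀≢j) (adjacent c Aa Ax₀ a≢x₀)

  clique-missing-j-neighbours : ∀ {A} → ¬ Meets-j-neighbour A → IsClique (Shift i j G) A ⇔ IsClique G A
  clique-missing-j-neighbours {A} ∄ = mk⇔ (IsClique-cong agree) (IsClique-cong (λ Ax Ay → sym (agree Ax Ay)))
    where
    agree : ∀ {x y} → lookup A x ≡ true → lookup A y ≡ true → Shift i j G x y ≡ G x y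
    agree {x} {y} Ax Ay =
      shift-off-j-neighbourhood (¬-not λ j∼x → ∄ (x , Ax , j∼x)) (¬-not λ j∼y → ∄ (y , Ay , j∼y))

  isCliqueᵇ-swap-if-meets : ∀ A → isCliqueᵇ (Shift i j G) A ≡ isCliqueᵇ G (swap-if-meets A)
  isCliqueᵇ-swap-if-meets A with meets-j-neighbour? A
  ... | yes (x₀ , Ax₀ , j∼x₀) = isCliqueᵇ-cong (clique-meeting-j-neighbour {A} Ax₀ j∼x₀)
  ... | no ∄                  = isCliqueᵇ-cong (clique-missing-j-neighbours {A} ∄)

  Tcount-shift : ∀ k → Tcount k G ≡ Tcount k (Shift i j G)
  Tcount-shift = Tcount-invariant swap-if-meets swap-if-meets-involutive ∣swap-if-meets∣ isCliqueᵇ-swap-if-meets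

-- The hypothesis i < j is unused: the argument never compares i and j.
lemma4p8 : ∀ (n : ℕ) (G : Graph n) (i j : Fin n) → IsSimple G → i < j
           → ¬ Path G i j
           → (Chordal G → Chordal (Shift i j G))
             × (∀ (k : ℕ) → Tcount k G ≡ Tcount k (Shift i j G))
lemma4p8 n G i j simple _ i↛j = chordal-shift , Tcount-shift
  where open DisjointShift G i j simple i↛j
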